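{- Let $H(n,\sigma)$ denote the minimum, over all decision trees processing strings of length $n$ that find the Lempel-Ziv factorization, of the maximum, over all strings $t$ of length $n$ over a totally ordered alphabet containing at most $\sigma$ distinct letters, of the number of comparisons (edges) on the path from the root to the leaf reached by $t$. Then $H(n,\sigma) = \Omega(n\log\sigma)$. In words: constructing the Lempel-Ziv factorization of a string of length $n$ with at most $\sigma$ distinct letters requires $\Omega(n\log\sigma)$ comparisons of letters in the worst case.
   Context: Strings are over a totally (linearly) ordered alphabet; $t[i]$ is the $i$th letter and $t[i..j]=t[i]\cdots t[j]$. $\log$ is base $2$. Lempel-Ziv factorization: for a string $t$ of length $n$, it is the decomposition $t=t_1t_2\cdots t_k$ built greedily from left to right: $t_1=t[1]$; if $t_1\cdots t_{i-1}=t[1..j]$, then if $t[j+1]$ does not occur in $t[1..j]$ put $t_i=t[j+1]$, otherwise let $t_i$ be the longest prefix of $t[j+1..n]$ that has an occurrence starting at some position $\le j$. Two factorizations $t=t_1\cdots t_k$ and $t'=t'_1\cdots t'_{k'}$ of strings of the same length are equivalent if $k=k'$ and $|t_i|=|t'_i|$ for all $i$. Decision tree model: a decision tree processing strings of length $n$ is a rooted ternary tree in which each interior vertex is labeled with an ordered pair $(i,j)$, $1\le i,j\le n$, and its three outgoing edges are labeled $<$, $=$, $>$. A string $t$ of length $n$ reaches a vertex $v$ if along the root-to-$v$ path, every vertex labeled $(i,j)$ is left via the edge labeled by the actual relation between $t[i]$ and $t[j]$; each string reaches exactly one leaf. The height is the maximal number of edges on a root-to-leaf path. A decision tree processing strings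 of length $n$ finds the Lempel-Ziv factorization if any two strings of length $n$ reaching the same leaf have equivalent Lempel-Ziv factorizations. -}

module Defs where

open import Data.Nat using (ℕ; zero; suc; _+_; _*_; _≤_; _<_; _≡ᵇ_; _⊔_)
open import Data.Nat.Properties using (<-cmp)
open import Data.Fin using (Fin)
open import Data.Vec using (Vec; lookup; toList)
open import Data.List using (List; []; _∷_; length; drop; take; map; foldr; upTo)
open import Data.List.Relation.Unary.All using (All)
open import Data.List.Membership.Propositional using (_∈_)
open import Data.Bool using (Bool; true; false; _∨_; if_then_else_)
open import Data.Product using (Σ; _×_)
open import Relation.Binary using (tri<; tri≈; tri>)
open import Relation.Binary.PropositionalEquality using (_≡_)

Str : ℕ → Set
Str n = Vec ℕ n

-- Decision trees processing strings of length n: each interior vertex is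
-- labelled by a pair (i , j) of positions and has three children, for the
-- outcomes t[i] < t[j], t[i] = t[j], t[i] > t[j] (in this order).
data DTree (n : ℕ) : Set where
  leaf : DTree n
  node : Fin n → Fin n → DTree n → DTree n → DTree n → DTree n

data Outcome : Set where
  lt eq gt : Outcome

compareLetters : ℕ → ℕ → Outcome
compareLetters a b with <-cmp a b
... | tri< _ _ _ = lt
... | tri≈ _ _ _ = eq
... | tri> _ _ _ = gt

-- The root-to-leaf path followed by t, as the sequence of edge labels.
-- Two strings reach the same leaf iff their routes coincide.
route : ∀ {n} → DTree n → Str n → List Outcome
route leaf t = []
route (node i j l e g) t with compareLetters (lookup t i) (lookup t j)
... | lt = lt ∷ route l t
... | eq = eq ∷ route e t
... | gt = gt ∷ route g t

depth : ∀ {n} → DTree n → Str n → ℕ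
depth T t = length (route T t)

elem : ℕ → List ℕ → Bool
elem a [] = false
elem a (b ∷ bs) = (a ≡ᵇ b) ∨ elem a bs

lcp : List ℕ → List ℕ → ℕ
lcp [] _ = 0
lcp (_ ∷ _) [] = 0
lcp (a ∷ as) (b ∷ bs) = if a ≡ᵇ b then suc (lcp as bs) else 0

-- Length of the LZ phrase starting at position j (j letters already
-- factorized): 1 if t[j] does not occur in t[0..j-1]; otherwise the
-- length of the longest prefix of t[j..] that has an occurrence in t
-- starting at some position i < j (overlaps allowed).
phraseLen : List ℕ → ℕ → ℕ
phraseLen t j with drop j t
... | [] = 0
... | (c ∷ _) =
  if elem c (take j t)
  then foldr _⊔_ 0 (map (λ i → lcp (drop i t) (drop j t)) (upTo j))
  else 1

-- Lengths of the LZ phrases of t[j..], using fuel (each phrase has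
-- length ≥ 1, so fuel = length t suffices).
lzFrom : ℕ → List ℕ → ℕ → List ℕ
lzFrom zero t j = []
lzFrom (suc fuel) t j with drop j t
... | [] = []
... | (_ ∷ _) = phraseLen t j ∷ lzFrom fuel t (j + phraseLen t j)

-- The LZ factorization of t, represented by the list |t_1|, ..., |t_k|
-- of phrase lengths (two factorizations are equivalent iff these lists
-- are equal).
lzLengths : List ℕ → List ℕ
lzLengths t = lzFrom (length t) t 0

FindsLZ : ∀ {n} → DTree n → Set
FindsLZ {n} T = (s t : Str n) → route T s ≡ route T t →
                lzLengths (toList s) ≡ lzLengths (toList t)

AtMostLetters : ∀ {n} → ℕ → Str n → Set
AtMostLetters σ t = Σ (List ℕ) λ L → length L ≤ σ × All (_∈ L) (toList t)

-- Fix a = 2^h letters with h ≈ (log σ)/4 and let P list all a² two-letter words. The strings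
-- P Q 0, for the a^r words Q of length r ≈ n/2, must reach pairwise distinct leaves. Otherwise
-- the letterwise merge x·a + y of two of them, P Q 0 and P Q' 0, compares exactly like both and
-- reaches the same leaf, so it has the same LZ factorization as P Q 0. But at the first position
-- where Q and Q' differ the merge has a fresh letter preceded only by "diagonal" letters, so an
-- LZ phrase of length 1 starts there; in P Q 0 a phrase starts there as well, and has length at
-- least 2 because the pair of letters beginning at that position already occurs in P. Hence some
-- string lies at depth at least log₃ (a^r), which is Ω(n log σ).

module Submission where

open import Defs
open import Data.Bool using (true; false; if_then_else_; T)
open import Data.Bool.Properties using (∨-zeroʳ)
open import Data.Fin using (Fin)
open import Data.List using (List; []; _∷_; _++_; length; drop; take; map; foldr; upTo; filter; concat; cartesianProductWith)
import Data.List as List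
open import Data.List.Membership.Propositional using (_∈_; _∉_)
open import Data.List.Membership.Propositional.Properties
  using (∈-map⁺; ∈-map⁻; ∈-upTo⁺; ∈-upTo⁻; ∈-filter⁻; ∈-concat⁻′; ∈-cartesianProductWith⁺; ∈-cartesianProductWith⁻)
open import Data.List.Properties using (drop-drop; length-++; length-++-≤ˡ; length-map; length-zipWith; length-upTo; ++-assoc; ∷-injective)
open import Data.List.Relation.Unary.All using (All; []; _∷_)
import Data.List.Relation.Unary.All as All
import Data.List.Relation.Unary.All.Properties as All
open import Data.List.Relation.Unary.AllPairs using (AllPairs; []; _∷_)
import Data.List.Relation.Unary.AllPairs.Properties as AllPairs
open import Data.List.Relation.Unary.Unique.Propositional using (Unique)
import Data.List.Relation.Unary.Unique.Propositional.Properties as Unique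
open import Data.List.Relation.Unary.Any using (here; there)
open import Data.Nat
open import Data.Vec using (Vec; lookup; zipWith; toList)
open import Data.Vec.Properties using (lookup-zipWith)
open import Data.Nat.Properties
open import Data.Nat.DivMod using (_%_; _/_; [m+kn]%n≡m%n; m<n⇒m%n≡m; m≡m%n+[m/n]*n; m%n<n; m/n*n≤m; m/n<m)
open import Data.Nat.Logarithm using (⌊log₂_⌋; ⌊log₂⌊n/2⌋⌋≡⌊log₂n⌋∸1)
open import Data.Nat.Tactic.RingSolver using (solve-∀)
open import Data.Product using (Σ; ∃-syntax; _×_; _,_; proj₁; proj₂)
open import Data.Sum using (inj₁; inj₂)
open import Data.Unit using (tt)
open import Function using (_∘_)
open import Relation.Nullary using (contradiction; yes; no)
open import Relation.Binary.Definitions using (DecidableEquality; tri<; tri≈; tri>)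
open import Relation.Binary.PropositionalEquality

module _ {A : Set} where

  ∈-take⇒drop : ∀ {c} j (xs : List A) → c ∈ take j xs → ∃[ i ] i < j × ∃[ r ] drop i xs ≡ c ∷ r
  ∈-take⇒drop (suc j) (x ∷ xs) (here refl) = 0 , z<s , xs , refl
  ∈-take⇒drop (suc j) (x ∷ xs) (there c∈) with ∈-take⇒drop j xs c∈
  ... | i , i<j , r , e = suc i , s<s i<j , r , e

  drop⇒∈-take : ∀ {c r} i j (xs : List A) → i < j → drop i xs ≡ c ∷ r → c ∈ take j xs
  drop⇒∈-take zero    (suc j) (x ∷ xs) _         refl = here refl
  drop⇒∈-take (suc i) (suc j) (x ∷ xs) (s≤s i<j) e   = there (drop⇒∈-take i j xs i<j e)

  drop-<-length : ∀ j (xs : List A) → j < length xs → ∃[ c ] ∃[ r ] drop j xs ≡ c ∷ r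
  drop-<-length zero    (x ∷ xs) _         = x , xs , refl
  drop-<-length (suc j) (x ∷ xs) (s≤s j<) = drop-<-length j xs j<

  drop-++-< : ∀ k (xs ys : List A) → k < length xs → ∃[ c ] c ∈ xs × ∃[ r ] drop k (xs ++ ys) ≡ c ∷ r
  drop-++-< zero    (x ∷ xs) ys _ = x , here refl , xs ++ ys , refl
  drop-++-< (suc k) (x ∷ xs) ys (s≤s k<) with drop-++-< k xs ys k<
  ... | c , c∈xs , r , e = c , there c∈xs , r , e

  drop-length-++ : ∀ (xs ys : List A) → drop (length xs) (xs ++ ys) ≡ ys
  drop-length-++ []       ys = refl
  drop-length-++ (x ∷ xs) ys = drop-length-++ xs ys

  take-length-++ : ∀ (xs ys : List A) → take (length xs) (xs ++ ys) ≡ xs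
  take-length-++ []       ys = refl
  take-length-++ (x ∷ xs) ys = cong (x ∷_) (take-length-++ xs ys)

  length-<-++-∷ : ∀ (xs : List A) {y ys} → length xs < length (xs ++ y ∷ ys)
  length-<-++-∷ xs = subst (length xs <_) (sym (length-++ xs)) (m<m+n (length xs) z<s)

  length-concat-uniform : ∀ {k} {xss : List (List A)} → All (λ xs → length xs ≡ k) xss →
                          length (concat xss) ≡ length xss * k
  length-concat-uniform []                          = refl
  length-concat-uniform {xss = xs ∷ _} (|xs| ∷ rest) =
    trans (length-++ xs) (cong₂ _+_ |xs| (length-concat-uniform rest))

  concat-infix : ∀ {xs : List A} {xss} → xs ∈ xss → ∃[ B ] ∃[ C ] concat xss ≡ B ++ xs ++ C
  concat-infix {xss = _ ∷ xss}  (here refl) = [] , concat xss , refl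
  concat-infix {xss = ys ∷ xss} (there xs∈) with concat-infix xs∈
  ... | B , C , e = ys ++ B , C , trans (cong (ys ++_) e) (sym (++-assoc ys B _))

  AllPairs-mapWithin : ∀ {P : A → Set} {R S : A → A → Set} →
                       (∀ {x y} → P x → P y → R x y → S x y) →
                       ∀ {xs} → All P xs → AllPairs R xs → AllPairs S xs
  AllPairs-mapWithin f []         []         = []
  AllPairs-mapWithin f (px ∷ pxs) (Rx ∷ Rxs) =
    All.zipWith (λ (py , r) → f px py r) (pxs , Rx) ∷ AllPairs-mapWithin f pxs Rxs

module _ {A B C : Set} (f : A → B → C) where

  length-cartesianProductWith : ∀ xs ys → length (cartesianProductWith f xs ys) ≡ length xs * length ys
  length-cartesianProductWith []       ys = refl
  length-cartesianProductWith (x ∷ xs) ys = begin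
    length (map (f x) ys ++ cartesianProductWith f xs ys)
      ≡⟨ length-++ (map (f x) ys) ⟩
    length (map (f x) ys) + length (cartesianProductWith f xs ys)
      ≡⟨ cong₂ _+_ (length-map (f x) ys) (length-cartesianProductWith xs ys) ⟩
    length ys + length xs * length ys
      ∎
    where open ≡-Reasoning

  zipWith-++ : ∀ xs xs' ys ys' → length xs ≡ length xs' →
               List.zipWith f (xs ++ ys) (xs' ++ ys') ≡ List.zipWith f xs xs' ++ List.zipWith f ys ys'
  zipWith-++ []       []         ys ys' _    = refl
  zipWith-++ (x ∷ xs) (x' ∷ xs') ys ys' |xs| = cong (f x x' ∷_) (zipWith-++ xs xs' ys ys' (suc-injective |xs|))

module _ {A C : Set} (f : A → A → C) where

  zipWith-diagonal : ∀ xs → List.zipWith f xs xs ≡ map (λ v → f v v) xs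
  zipWith-diagonal []       = refl
  zipWith-diagonal (x ∷ xs) = cong (f x x ∷_) (zipWith-diagonal xs)

-- Lempel-Ziv phrases

≡ᵇ-refl : ∀ a → (a ≡ᵇ a) ≡ true
≡ᵇ-refl zero    = refl
≡ᵇ-refl (suc a) = ≡ᵇ-refl a

≡ᵇ-true⇒≡ : ∀ a b → (a ≡ᵇ b) ≡ true → a ≡ b
≡ᵇ-true⇒≡ a b e = ≡ᵇ⇒≡ a b (subst T (sym e) tt)

≢⇒≡ᵇ-false : ∀ {a b} → a ≢ b → (a ≡ᵇ b) ≡ false
≢⇒≡ᵇ-false {a} {b} a≢b with a ≡ᵇ b in e
... | false = refl
... | true  = contradiction (≡ᵇ-true⇒≡ a b e) a≢b

elem-complete : ∀ {c xs} → c ∈ xs → elem c xs ≡ true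
elem-complete {c} (here refl) rewrite ≡ᵇ-refl c = refl
elem-complete {c} (there {x} c∈xs) rewrite elem-complete c∈xs = ∨-zeroʳ (c ≡ᵇ x)

elem-sound : ∀ {c} xs → elem c xs ≡ true → c ∈ xs
elem-sound {c} (x ∷ xs) found with c ≡ᵇ x in e
... | true  = here (≡ᵇ-true⇒≡ c x e)
... | false = there (elem-sound xs found)

elem-∉ : ∀ {c xs} → c ∉ xs → elem c xs ≡ false
elem-∉ {xs = []}     _   = refl
elem-∉ {c} {x ∷ xs} c∉ rewrite ≢⇒≡ᵇ-false (c∉ ∘ here) = elem-∉ (c∉ ∘ there)

max₀ : List ℕ → ℕ
max₀ = foldr _⊔_ 0

∈⇒≤max₀ : ∀ {x xs} → x ∈ xs → x ≤ max₀ xs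
∈⇒≤max₀ {xs = y ∷ ys} (here refl) = m≤m⊔n y (max₀ ys)
∈⇒≤max₀ {xs = y ∷ ys} (there x∈) = ≤-trans (∈⇒≤max₀ x∈) (m≤n⊔m y (max₀ ys))

max₀-lub : ∀ {k xs} → All (_≤ k) xs → max₀ xs ≤ k
max₀-lub []            = z≤n
max₀-lub (x≤k ∷ xs≤k) = ⊔-lub x≤k (max₀-lub xs≤k)

lcp-≤-mismatch : ∀ k (xs ys : List ℕ) {x y r r'} → drop k xs ≡ x ∷ r → drop k ys ≡ y ∷ r' →
                 x ≢ y → lcp xs ys ≤ k
lcp-≤-mismatch zero    (x ∷ xs) (y ∷ ys) refl refl x≢y rewrite ≢⇒≡ᵇ-false x≢y = z≤n
lcp-≤-mismatch (suc k) (x ∷ xs) (y ∷ ys) ex ey x≢y with x ≡ᵇ y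
... | true  = s≤s (lcp-≤-mismatch k xs ys ex ey x≢y)
... | false = z≤n

lcp-common-pair : ∀ c d r r' → 2 ≤ lcp (c ∷ d ∷ r) (c ∷ d ∷ r')
lcp-common-pair c d r r' rewrite ≡ᵇ-refl c | ≡ᵇ-refl d = s≤s (s≤s z≤n)

lcp-common-head : ∀ c r r' → 1 ≤ lcp (c ∷ r) (c ∷ r')
lcp-common-head c r r' rewrite ≡ᵇ-refl c = s≤s z≤n

longestEarlierMatch : List ℕ → ℕ → ℕ
longestEarlierMatch t j = max₀ (map (λ i → lcp (drop i t) (drop j t)) (upTo j))

phraseLen-unfold : ∀ t j {c r} → drop j t ≡ c ∷ r →
                   phraseLen t j ≡ (if elem c (take j t) then longestEarlierMatch t j else 1)
phraseLen-unfold t j {c} e rewrite e =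
  cong (λ w → if elem c (take j t) then max₀ (map (λ i → lcp (drop i t) w) (upTo j)) else 1) e

phraseLen-≥-lcp : ∀ t {i j c r r'} → i < j → drop i t ≡ c ∷ r' → drop j t ≡ c ∷ r →
                  lcp (drop i t) (drop j t) ≤ phraseLen t j
phraseLen-≥-lcp t {i} {j} i<j ei ej
  rewrite phraseLen-unfold t j ej | elem-complete (drop⇒∈-take i j t i<j ei) =
  ∈⇒≤max₀ (∈-map⁺ (λ i → lcp (drop i t) (drop j t)) (∈-upTo⁺ i<j))

phraseLen-≥1 : ∀ t j {c r} → drop j t ≡ c ∷ r → 1 ≤ phraseLen t j
phraseLen-≥1 t j {c} {r} ej with elem c (take j t) in found
... | false rewrite phraseLen-unfold t j ej | found = ≤-refl
... | true with ∈-take⇒drop j t (elem-sound (take j t) found)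
... | i , i<j , r' , ei = ≤-trans (subst (1 ≤_) (cong₂ lcp (sym ei) (sym ej)) (lcp-common-head c r' r))
                                  (phraseLen-≥-lcp t i<j ei ej)

phraseLen-fresh : ∀ t j {c r} → drop j t ≡ c ∷ r → c ∉ take j t → phraseLen t j ≡ 1
phraseLen-fresh t j ej c∉ rewrite phraseLen-unfold t j ej | elem-∉ c∉ = refl

phraseLen-≤ : ∀ t j {c r k} → drop j t ≡ c ∷ r → 1 ≤ k →
              (∀ i → i < j → lcp (drop i t) (drop j t) ≤ k) → phraseLen t j ≤ k
phraseLen-≤ t j {c} ej 1≤k lcp≤k rewrite phraseLen-unfold t j ej with elem c (take j t)
... | true  = max₀-lub (All.map⁺ (All.map (lcp≤k _) (All.all-upTo j)))
... | false = 1≤k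

phraseLen-≥2 : ∀ t {i j c d r r'} → i < j → drop i t ≡ c ∷ d ∷ r' → drop j t ≡ c ∷ d ∷ r → 2 ≤ phraseLen t j
phraseLen-≥2 t {c = c} {d} {r} {r'} i<j ei ej =
  ≤-trans (subst (2 ≤_) (cong₂ lcp (sym ei) (sym ej)) (lcp-common-pair c d r' r)) (phraseLen-≥-lcp t i<j ei ej)

lzStep : ℕ → List ℕ → ℕ → List ℕ → List ℕ
lzStep fuel t j []      = []
lzStep fuel t j (_ ∷ _) = phraseLen t j ∷ lzFrom fuel t (j + phraseLen t j)

lzFrom-suc : ∀ fuel t j → lzFrom (suc fuel) t j ≡ lzStep fuel t j (drop j t)
lzFrom-suc fuel t j with drop j t
... | []    = refl
... | _ ∷ _ = refl

lzFrom-unfold : ∀ fuel t j {c r} → drop j t ≡ c ∷ r →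
                lzFrom (suc fuel) t j ≡ phraseLen t j ∷ lzFrom fuel t (j + phraseLen t j)
lzFrom-unfold fuel t j e = trans (lzFrom-suc fuel t j) (cong (lzStep fuel t j) e)

PhrasesEndBy : List ℕ → ℕ → Set
PhrasesEndBy t p = ∀ j → j < p → 1 ≤ phraseLen t j × j + phraseLen t j ≤ p

-- Phrases of U never cross p, so a factorization common to S and U has a phrase starting at p.
module _ {S U : List ℕ} {p : ℕ} (U-ends : PhrasesEndBy U p) (U-short : phraseLen U p ≡ 1)
         (S-long : 2 ≤ phraseLen S p) (p<S : p < length S) (p<U : p < length U) where

  lzFrom-split-at : ∀ fuel j → j ≤ p → p ∸ j < fuel → lzFrom fuel S j ≢ lzFrom fuel U j
  lzFrom-split-at (suc fuel) j j≤p p∸j<fuel same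
    with drop-<-length j S (≤-<-trans j≤p p<S) | drop-<-length j U (≤-<-trans j≤p p<U)
  ... | _ , _ , eS | _ , _ , eU
    with ∷-injective (trans (sym (lzFrom-unfold fuel S j eS)) (trans same (lzFrom-unfold fuel U j eU)))
  ... | sameLen , sameRest with m≤n⇒m<n∨m≡n j≤p
  ... | inj₂ refl = 1+n≰n (subst (2 ≤_) (trans sameLen U-short) S-long)
  ... | inj₁ j<p  = lzFrom-split-at fuel (j + phraseLen U j) (proj₂ (U-ends j j<p)) progress
                      (subst (λ ℓ → lzFrom fuel S (j + ℓ) ≡ _) sameLen sameRest)
    where
    progress : p ∸ (j + phraseLen U j) < fuel
    progress = <-≤-trans (∸-monoʳ-< (m<m+n j (proj₁ (U-ends j j<p))) (proj₂ (U-ends j j<p)))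
                         (s≤s⁻¹ p∸j<fuel)

  lzLengths-split-at : length S ≡ length U → lzLengths S ≢ lzLengths U
  lzLengths-split-at |S|≡|U| same =
    lzFrom-split-at (length U) 0 z≤n p<U (subst (λ m → lzFrom m S 0 ≡ lzFrom (length U) U 0) |S|≡|U| same)

module _ (A : List ℕ) (z : ℕ) (R : List ℕ) (z∉A : z ∉ A) where

  private
    U : List ℕ
    U = A ++ z ∷ R

    p : ℕ
    p = length A

  lcp-≤-distance-to-fresh : ∀ i j → i < j → j ≤ p → lcp (drop i U) (drop j U) ≤ p ∸ j
  lcp-≤-distance-to-fresh i j i<j j≤p
    with drop-++-< (i + (p ∸ j)) A (z ∷ R) (subst (i + (p ∸ j) <_) (m+[n∸m]≡n j≤p) (+-monoˡ-< (p ∸ j) i<j))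
  ... | c , c∈A , r , ec = lcp-≤-mismatch (p ∸ j) (drop i U) (drop j U)
                              (trans (drop-drop i (p ∸ j) U) ec) reaches-z
                              (λ c≡z → z∉A (subst (_∈ A) c≡z c∈A))
    where
    reaches-z : drop (p ∸ j) (drop j U) ≡ z ∷ R
    reaches-z = begin
      drop (p ∸ j) (drop j U) ≡⟨ drop-drop j (p ∸ j) U ⟩
      drop (j + (p ∸ j)) U    ≡⟨ cong (λ k → drop k U) (m+[n∸m]≡n j≤p) ⟩
      drop p U                ≡⟨ drop-length-++ A (z ∷ R) ⟩
      z ∷ R                   ∎
      where open ≡-Reasoning

  phrases-end-at-fresh : PhrasesEndBy U p
  phrases-end-at-fresh j j<p with drop-<-length j U (<-≤-trans j<p (length-++-≤ˡ A))
  ... | c , r , ej = phraseLen-≥1 U j ej , ends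
    where
    ≤p∸j : phraseLen U j ≤ p ∸ j
    ≤p∸j = phraseLen-≤ U j ej (m<n⇒0<n∸m j<p) (λ i i<j → lcp-≤-distance-to-fresh i j i<j (<⇒≤ j<p))

    ends : j + phraseLen U j ≤ p
    ends = ≤-trans (+-monoʳ-≤ j ≤p∸j) (≤-reflexive (m+[n∸m]≡n (<⇒≤ j<p)))

  phraseLen-at-fresh : phraseLen U p ≡ 1
  phraseLen-at-fresh = phraseLen-fresh U p (drop-length-++ A (z ∷ R))
                         (subst (z ∉_) (sym (take-length-++ A (z ∷ R))) z∉A)

-- Decision trees

_≟ₒ_ : DecidableEquality Outcome
lt ≟ₒ lt = yes refl
eq ≟ₒ eq = yes refl
gt ≟ₒ gt = yes refl
lt ≟ₒ eq = no λ ()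
lt ≟ₒ gt = no λ ()
eq ≟ₒ lt = no λ ()
eq ≟ₒ gt = no λ ()
gt ≟ₒ lt = no λ ()
gt ≟ₒ eq = no λ ()

sum₃≤3* : ∀ {a b c m} → a ≤ m → b ≤ m → c ≤ m → a + b + c ≤ 3 * m
sum₃≤3* {m = m} a≤m b≤m c≤m = ≤-trans (+-mono-≤ (+-mono-≤ a≤m b≤m) c≤m)
  (≤-reflexive (trans (cong (m + m +_) (sym (+-identityʳ m))) (+-assoc m m (m + 0))))

∃-largest-outcome : (f : Outcome → ℕ) → ∃[ o ] f lt + f eq + f gt ≤ 3 * f o
∃-largest-outcome f with ≤-total (f lt) (f eq) | ≤-total (f eq) (f gt) | ≤-total (f lt) (f gt)
... | inj₁ l≤e | inj₁ e≤g | _        = gt , sum₃≤3* (≤-trans l≤e e≤g) e≤g ≤-refl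
... | inj₁ l≤e | inj₂ g≤e | _        = eq , sum₃≤3* l≤e ≤-refl g≤e
... | inj₂ e≤l | _        | inj₁ l≤g = gt , sum₃≤3* l≤g (≤-trans e≤l l≤g) ≤-refl
... | inj₂ e≤l | _        | inj₂ g≤l = lt , sum₃≤3* ≤-refl e≤l g≤l

module _ {n : ℕ} where

  outcome : Fin n → Fin n → Str n → Outcome
  outcome i j s = compareLetters (lookup s i) (lookup s j)

  child : Outcome → DTree n → DTree n → DTree n → DTree n
  child lt l e g = l
  child eq l e g = e
  child gt l e g = g

  route-node : ∀ i j l e g (s : Str n) →
               route (node i j l e g) s ≡ outcome i j s ∷ route (child (outcome i j s) l e g) s
  route-node i j l e g s with compareLetters (lookup s i) (lookup s j)
  ... | lt = refl
  ... | eq = refl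
  ... | gt = refl

  Separates : DTree n → List (Str n) → Set
  Separates T = AllPairs (λ s t → route T s ≢ route T t)

  module _ (i j : Fin n) where

    branch : Outcome → List (Str n) → List (Str n)
    branch o = filter (λ s → outcome i j s ≟ₒ o)

    length-branches : ∀ xs → length xs ≡ length (branch lt xs) + length (branch eq xs) + length (branch gt xs)
    length-branches []       = refl
    length-branches (x ∷ xs) with outcome i j x
    ... | lt = cong suc (length-branches xs)
    ... | eq = trans (cong suc (length-branches xs)) (cong (_+ length (branch gt xs)) (sym (+-suc _ _)))
    ... | gt = trans (cong suc (length-branches xs)) (sym (+-suc _ _))

  separates-branch : ∀ i j l e g o {xs} → Separates (node i j l e g) xs →
                     Separates (child o l e g) (branch i j o xs)
  separates-branch i j l e g o {xs} sep =
    AllPairs-mapWithin same-child (All.all-filter (λ s → outcome i j s ≟ₒ o) xs) (AllPairs.filter⁺ _ sep)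
    where
    same-child : ∀ {s t} → outcome i j s ≡ o → outcome i j t ≡ o →
                 route (node i j l e g) s ≢ route (node i j l e g) t → route (child o l e g) s ≢ route (child o l e g) t
    same-child {s} {t} refl ot≡o differ same = differ (begin
      route (node i j l e g) s                               ≡⟨ route-node i j l e g s ⟩
      o ∷ route (child o l e g) s                            ≡⟨ cong (o ∷_) same ⟩
      o ∷ route (child o l e g) t                            ≡⟨ cong (λ o' → o' ∷ route (child o' l e g) t) (sym ot≡o) ⟩
      outcome i j t ∷ route (child (outcome i j t) l e g) t  ≡⟨ sym (route-node i j l e g t) ⟩
      route (node i j l e g) t                               ∎)
      where open ≡-Reasoning

  deep-member : ∀ T xs → Separates T xs → 1 ≤ length xs → ∃[ t ] t ∈ xs × length xs ≤ 3 ^ depth T t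
  deep-member leaf (x ∷ [])           _                _ = x , here refl , ≤-refl
  deep-member leaf (x ∷ y ∷ _) ((x≢y ∷ _) ∷ _)      _ = contradiction refl x≢y
  deep-member (node i j l e g) xs sep nonempty = t , proj₁ t∈xs,o , xs≤3^depth
    where
    largest : ∃[ o ] length (branch i j lt xs) + length (branch i j eq xs) + length (branch i j gt xs)
                         ≤ 3 * length (branch i j o xs)
    largest = ∃-largest-outcome (λ o → length (branch i j o xs))

    o : Outcome
    o = proj₁ largest

    ys : List (Str n)
    ys = branch i j o xs

    xs≤3*ys : length xs ≤ 3 * length ys
    xs≤3*ys = subst (_≤ 3 * length ys) (sym (length-branches i j xs))
                    (proj₂ largest)

    nonempty-ys : 1 ≤ length ys
    nonempty-ys with length ys in len
    ... | zero  = contradiction (≤-trans nonempty (subst (λ m → length xs ≤ 3 * m) len xs≤3*ys)) (λ ())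
    ... | suc _ = s≤s z≤n

    deep-child : ∀ o zs → Separates (child o l e g) zs → 1 ≤ length zs →
                 ∃[ t ] t ∈ zs × length zs ≤ 3 ^ depth (child o l e g) t
    deep-child lt = deep-member l
    deep-child eq = deep-member e
    deep-child gt = deep-member g

    deep-in-ys : ∃[ t ] t ∈ ys × length ys ≤ 3 ^ depth (child o l e g) t
    deep-in-ys = deep-child o ys (separates-branch i j l e g o sep) nonempty-ys
    t : Str n
    t = proj₁ deep-in-ys

    t∈xs,o : t ∈ xs × outcome i j t ≡ o
    t∈xs,o = ∈-filter⁻ (λ s → outcome i j s ≟ₒ o) (proj₁ (proj₂ deep-in-ys))

    depth-t : depth (node i j l e g) t ≡ suc (depth (child o l e g) t)
    depth-t = cong length (trans (route-node i j l e g t)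
                                 (cong (λ o' → o' ∷ route (child o' l e g) t) (proj₂ t∈xs,o)))

    xs≤3^depth : length xs ≤ 3 ^ depth (node i j l e g) t
    xs≤3^depth = ≤-trans xs≤3*ys (≤-trans (*-monoʳ-≤ 3 (proj₂ (proj₂ deep-in-ys)))
                                          (≤-reflexive (cong (3 ^_) (sym depth-t))))

Holds : Outcome → ℕ → ℕ → Set
Holds lt x y = x < y
Holds eq x y = x ≡ y
Holds gt x y = y < x

compareLetters-holds : ∀ x y → Holds (compareLetters x y) x y
compareLetters-holds x y with <-cmp x y
... | tri< x<y _ _ = x<y
... | tri≈ _ x≡y _ = x≡y
... | tri> _ _ y<x = y<x

compareLetters-unique : ∀ o x y → Holds o x y → compareLetters x y ≡ o
compareLetters-unique o x y h with <-cmp x y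
compareLetters-unique lt x y h | tri< _ _ _   = refl
compareLetters-unique lt x y h | tri≈ _ x≡y _ = contradiction x≡y (<⇒≢ h)
compareLetters-unique lt x y h | tri> y≮x _ _ = contradiction h y≮x
compareLetters-unique eq x y h | tri< _ x≢y _ = contradiction h x≢y
compareLetters-unique eq x y h | tri≈ _ _ _   = refl
compareLetters-unique eq x y h | tri> _ x≢y _ = contradiction h x≢y
compareLetters-unique gt x y h | tri< _ _ y≮x = contradiction h y≮x
compareLetters-unique gt x y h | tri≈ _ _ y≮x = contradiction h y≮x
compareLetters-unique gt x y h | tri> _ _ _   = refl

PreservesOutcomes : (ℕ → ℕ → ℕ) → Set
PreservesOutcomes f = ∀ o {a a' c c'} → Holds o a a' → Holds o c c' → Holds o (f a c) (f a' c')

route-zipWith : ∀ {n} {f} → PreservesOutcomes f → (T : DTree n) (s t : Str n) →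
                route T s ≡ route T t → route T (zipWith f s t) ≡ route T s
route-zipWith pres leaf s t _ = refl
route-zipWith {n} {f} pres (node i j l e g) s t same = begin
  route (node i j l e g) u                                 ≡⟨ route-node i j l e g u ⟩
  outcome i j u ∷ route (child (outcome i j u) l e g) u    ≡⟨ cong (λ o → o ∷ route (child o l e g) u) u≡s ⟩
  outcome i j s ∷ route (child (outcome i j s) l e g) u    ≡⟨ cong (outcome i j s ∷_) (in-child (outcome i j s) tails) ⟩
  outcome i j s ∷ route (child (outcome i j s) l e g) s    ≡⟨ sym (route-node i j l e g s) ⟩
  route (node i j l e g) s                                 ∎
  where
  open ≡-Reasoning
  u : Str n
  u = zipWith f s t

  split : outcome i j s ≡ outcome i j t × route (child (outcome i j s) l e g) s ≡ route (child (outcome i j t) l e g) t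
  split = ∷-injective (trans (sym (route-node i j l e g s)) (trans same (route-node i j l e g t)))

  heads : outcome i j s ≡ outcome i j t
  heads = proj₁ split

  tails : route (child (outcome i j s) l e g) s ≡ route (child (outcome i j s) l e g) t
  tails = trans (proj₂ split) (cong (λ o → route (child o l e g) t) (sym heads))

  u≡s : outcome i j u ≡ outcome i j s
  u≡s rewrite lookup-zipWith f i s t | lookup-zipWith f j s t =
    compareLetters-unique (outcome i j s) _ _
      (pres (outcome i j s) (compareLetters-holds (lookup s i) (lookup s j))
            (subst (λ o → Holds o (lookup t i) (lookup t j)) (sym heads) (compareLetters-holds (lookup t i) (lookup t j))))

  in-child : ∀ o → route (child o l e g) s ≡ route (child o l e g) t → route (child o l e g) u ≡ route (child o l e g) s
  in-child lt = route-zipWith pres l s t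
  in-child eq = route-zipWith pres e s t
  in-child gt = route-zipWith pres g s t

twoDigit : ℕ → ℕ → ℕ → ℕ
twoDigit b x y = x * b + y

twoDigit-preservesOutcomes : ∀ b → PreservesOutcomes (twoDigit b)
twoDigit-preservesOutcomes b lt a<a' c<c' = +-mono-≤-< (*-monoˡ-≤ b (<⇒≤ a<a')) c<c'
twoDigit-preservesOutcomes b eq refl refl = refl
twoDigit-preservesOutcomes b gt a'<a c'<c = +-mono-≤-< (*-monoˡ-≤ b (<⇒≤ a'<a)) c'<c

twoDigit-injective : ∀ b {x y x' y'} → y < b → y' < b → twoDigit b x y ≡ twoDigit b x' y' → x ≡ x' × y ≡ y'
twoDigit-injective b@(suc _) {x} {y} {x'} {y'} y<b y'<b same = x≡x' , y≡y'
  where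
  open ≡-Reasoning
  y≡y' : y ≡ y'
  y≡y' = begin
    y                ≡⟨ sym (m<n⇒m%n≡m y<b) ⟩
    y % b            ≡⟨ sym ([m+kn]%n≡m%n y x b) ⟩
    (y + x * b) % b  ≡⟨ cong (_% b) (trans (+-comm y (x * b)) (trans same (+-comm (x' * b) y'))) ⟩
    (y' + x' * b) % b ≡⟨ [m+kn]%n≡m%n y' x' b ⟩
    y' % b           ≡⟨ m<n⇒m%n≡m y'<b ⟩
    y'               ∎

  x≡x' : x ≡ x'
  x≡x' = *-cancelʳ-≡ x x' b (+-cancelʳ-≡ y (x * b) (x' * b) (trans same (cong (x' * b +_) (sym y≡y'))))

-- The hard strings

module _ {A : Set} where

  words : List A → ℕ → List (List A)
  words L zero    = [] ∷ []
  words L (suc r) = cartesianProductWith _∷_ L (words L r)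

  length-words : ∀ L r → length (words L r) ≡ length L ^ r
  length-words L zero    = refl
  length-words L (suc r) = trans (length-cartesianProductWith _∷_ L (words L r)) (cong (length L *_) (length-words L r))

  words-unique : ∀ {L} → Unique L → ∀ r → Unique (words L r)
  words-unique L! zero    = [] ∷ []
  words-unique L! (suc r) = Unique.cartesianProductWith⁺ _∷_ ∷-injective L! (words-unique L! r)

  ∈-words⁻ : ∀ L r {Q} → Q ∈ words L r → length Q ≡ r × All (_∈ L) Q
  ∈-words⁻ L zero    (here refl) = refl , []
  ∈-words⁻ L (suc r) Q∈ with ∈-cartesianProductWith⁻ _∷_ L (words L r) Q∈
  ... | x , Q' , x∈L , Q'∈ , refl with ∈-words⁻ L r Q'∈
  ... | |Q'| , Q'⊆L = cong suc |Q'| , x∈L ∷ Q'⊆L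

  pairs : List A → List A
  pairs L = concat (cartesianProductWith (λ x y → x ∷ y ∷ []) L L)

  length-pairs : ∀ L → length (pairs L) ≡ length L * length L * 2
  length-pairs L = trans (length-concat-uniform (All.tabulate two))
                         (cong (_* 2) (length-cartesianProductWith (λ x y → x ∷ y ∷ []) L L))
    where
    two : ∀ {xs} → xs ∈ cartesianProductWith (λ x y → x ∷ y ∷ []) L L → length xs ≡ 2
    two xs∈ with ∈-cartesianProductWith⁻ (λ x y → x ∷ y ∷ []) L L xs∈
    ... | _ , _ , _ , _ , refl = refl

  pairs-infix : ∀ {L x y} → x ∈ L → y ∈ L → ∃[ B ] ∃[ C ] pairs L ≡ B ++ x ∷ y ∷ C
  pairs-infix x∈L y∈L = concat-infix (∈-cartesianProductWith⁺ (λ x y → x ∷ y ∷ []) x∈L y∈L)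

  pairs-letters : ∀ L → All (_∈ L) (pairs L)
  pairs-letters L = All.tabulate λ v∈ → from-pair (∈-concat⁻′ (cartesianProductWith (λ x y → x ∷ y ∷ []) L L) v∈)
    where
    from-pair : ∀ {v} → ∃[ xs ] v ∈ xs × xs ∈ cartesianProductWith (λ x y → x ∷ y ∷ []) L L → v ∈ L
    from-pair (_ , v∈xs , xs∈) with ∈-cartesianProductWith⁻ (λ x y → x ∷ y ∷ []) L L xs∈
    from-pair (_ , here refl , _)         | _ , _ , x∈L , _   , refl = x∈L
    from-pair (_ , there (here refl) , _) | _ , _ , _   , y∈L , refl = y∈L

hardString : ℕ → List ℕ → List ℕ
hardString a Q = pairs (upTo a) ++ Q ++ 0 ∷ []

hardString-split : ∀ a C x R → hardString a (C ++ x ∷ R) ≡ (pairs (upTo a) ++ C) ++ x ∷ (R ++ 0 ∷ [])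
hardString-split a C x R = trans (cong (pairs (upTo a) ++_) (++-assoc C (x ∷ R) (0 ∷ [])))
                                 (sym (++-assoc (pairs (upTo a)) C (x ∷ R ++ 0 ∷ [])))

length-hardString : ∀ a Q → length (hardString a Q) ≡ length (pairs (upTo a)) + (length Q + 1)
length-hardString a Q = trans (length-++ (pairs (upTo a))) (cong (length (pairs (upTo a)) +_) (length-++ Q))

module _ {a : ℕ} {C : List ℕ} {x y y' : ℕ} {rest W : List ℕ}
         (x≢y : x ≢ y) (C<a : All (_< a) C) (x<a : x < a) (y<a : y < a) (y'<a : y' < a)
         (|W| : length W ≡ suc (length rest)) where

  private
    PC : List ℕ
    PC = pairs (upTo a) ++ C

    S S' : List ℕ
    S  = PC ++ x ∷ y' ∷ rest
    S' = PC ++ y ∷ W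

    A R : List ℕ
    A = map (λ v → twoDigit a v v) PC
    R = List.zipWith (twoDigit a) (y' ∷ rest) W

    z p : ℕ
    z = twoDigit a x y
    p = length A

    p≡|PC| : p ≡ length PC
    p≡|PC| = length-map (λ v → twoDigit a v v) PC

    merged : List.zipWith (twoDigit a) S S' ≡ A ++ z ∷ R
    merged = trans (zipWith-++ (twoDigit a) PC PC (x ∷ y' ∷ rest) (y ∷ W) refl)
                   (cong (_++ z ∷ R) (zipWith-diagonal (twoDigit a) PC))

    PC<a : All (_< a) PC
    PC<a = All.++⁺ (All.map ∈-upTo⁻ (pairs-letters (upTo a))) C<a

    z∉A : z ∉ A
    z∉A z∈A with ∈-map⁻ (λ v → twoDigit a v v) z∈A
    ... | v , v∈PC , z≡vv with twoDigit-injective a y<a (All.lookup PC<a v∈PC) z≡vv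
    ... | x≡v , y≡v = x≢y (trans x≡v (sym y≡v))

    |S|≡|S'| : length S ≡ length S'
    |S|≡|S'| = trans (length-++ PC) (trans (cong (λ m → length PC + suc m) (sym |W|)) (sym (length-++ PC)))

    |S|≡|U| : length S ≡ length (A ++ z ∷ R)
    |S|≡|U| = trans (sym (⊓-idem (length S))) (trans (cong (length S ⊓_) |S|≡|S'|)
                (trans (sym (length-zipWith (twoDigit a) S S')) (cong length merged)))

    p<S : p < length S
    p<S = subst (_< length S) (sym p≡|PC|) (length-<-++-∷ PC)

    at-p : drop p S ≡ x ∷ y' ∷ rest
    at-p = trans (cong (λ k → drop k S) p≡|PC|) (drop-length-++ PC (x ∷ y' ∷ rest))

    S-long : 2 ≤ phraseLen S p
    S-long = from-occurrence (pairs-infix (∈-upTo⁺ x<a) (∈-upTo⁺ y'<a))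
      where
      from-occurrence : ∃[ B ] ∃[ C' ] pairs (upTo a) ≡ B ++ x ∷ y' ∷ C' → 2 ≤ phraseLen S p
      from-occurrence (B , C' , P≡) = phraseLen-≥2 S earlier-pair earlier at-p
        where
        open ≡-Reasoning
        earlier : drop (length B) S ≡ x ∷ y' ∷ (C' ++ C ++ x ∷ y' ∷ rest)
        earlier = begin
          drop (length B) ((pairs (upTo a) ++ C) ++ x ∷ y' ∷ rest) ≡⟨ cong (λ P → drop (length B) ((P ++ C) ++ x ∷ y' ∷ rest)) P≡ ⟩
          drop (length B) (((B ++ x ∷ y' ∷ C') ++ C) ++ x ∷ y' ∷ rest)
            ≡⟨ cong (drop (length B)) (trans (++-assoc (B ++ x ∷ y' ∷ C') C _) (++-assoc B (x ∷ y' ∷ C') _)) ⟩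
          drop (length B) (B ++ x ∷ y' ∷ C' ++ C ++ x ∷ y' ∷ rest)  ≡⟨ drop-length-++ B _ ⟩
          x ∷ y' ∷ C' ++ C ++ x ∷ y' ∷ rest                        ∎

        earlier-pair : length B < p
        earlier-pair = subst (length B <_) (sym p≡|PC|)
          (<-≤-trans (subst (λ P → length B < length P) (sym P≡) (length-<-++-∷ B)) (length-++-≤ˡ (pairs (upTo a))))

  lzLengths-merge-≢ : lzLengths S ≢ lzLengths (List.zipWith (twoDigit a) S S')
  lzLengths-merge-≢ same =
    lzLengths-split-at (phrases-end-at-fresh A z R z∉A) (phraseLen-at-fresh A z R z∉A) S-long p<S
      (subst (p <_) |S|≡|U| p<S) |S|≡|U| (trans same (cong lzLengths merged))

-- Pads with 0 or truncates; only applied to lists of length n.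
toStr : ∀ n → List ℕ → Str n
toStr zero    _        = Vec.[]
toStr (suc n) []       = 0 Vec.∷ toStr n []
toStr (suc n) (x ∷ xs) = x Vec.∷ toStr n xs

toList-toStr : ∀ {n} xs → length xs ≡ n → toList (toStr n xs) ≡ xs
toList-toStr {zero}  []       _    = refl
toList-toStr {suc n} (x ∷ xs) |xs| = cong (x ∷_) (toList-toStr xs (suc-injective |xs|))

toList-zipWith : ∀ {n} (f : ℕ → ℕ → ℕ) (s t : Str n) → toList (zipWith f s t) ≡ List.zipWith f (toList s) (toList t)
toList-zipWith f Vec.[]       Vec.[]       = refl
toList-zipWith f (x Vec.∷ s) (y Vec.∷ t) = cong (f x y ∷_) (toList-zipWith f s t)

first-difference : ∀ (Q Q' : List ℕ) → length Q ≡ length Q' → Q ≢ Q' →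
  ∃[ C ] ∃[ x ] ∃[ y ] ∃[ R ] ∃[ R' ] Q ≡ C ++ x ∷ R × Q' ≡ C ++ y ∷ R' × x ≢ y × length R ≡ length R'
first-difference []      []        _   Q≢Q' = contradiction refl Q≢Q'
first-difference (x ∷ Q) (y ∷ Q') |Q| Q≢Q' with x ≟ y
... | no x≢y   = [] , x , y , Q , Q' , refl , refl , x≢y , suc-injective |Q|
... | yes refl with first-difference Q Q' (suc-injective |Q|) (Q≢Q' ∘ cong (x ∷_))
... | C , x' , y' , R , R' , e , e' , x'≢y' , |R| =
  x ∷ C , x' , y' , R , R' , cong (x ∷_) e , cong (x ∷_) e' , x'≢y' , |R|

++-[0]-head : ∀ {a} R → 0 < a → All (_< a) R → ∃[ y' ] ∃[ rest ] R ++ 0 ∷ [] ≡ y' ∷ rest × y' < a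
++-[0]-head []      0<a _           = 0 , [] , refl , 0<a
++-[0]-head (v ∷ R) _   (v<a ∷ _) = v , R ++ 0 ∷ [] , refl , v<a

module _ {n a r : ℕ} (0<a : 0 < a) (|hardString| : length (pairs (upTo a)) + 1 + r ≡ n)
         (T : DTree n) (findsLZ : FindsLZ T) where

  hard : List ℕ → Str n
  hard Q = toStr n (hardString a Q)

  toList-hard : ∀ {Q} → length Q ≡ r → toList (hard Q) ≡ hardString a Q
  toList-hard {Q} |Q| = toList-toStr (hardString a Q)
    (trans (length-hardString a Q) (trans (cong (λ m → length (pairs (upTo a)) + (m + 1)) |Q|)
           (trans (cong (length (pairs (upTo a)) +_) (+-comm r 1)) (trans (sym (+-assoc _ 1 r)) |hardString|))))

  hard-routes-distinct : ∀ {Q Q'} → length Q ≡ r → length Q' ≡ r → All (_< a) Q → All (_< a) Q' →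
                         Q ≢ Q' → route T (hard Q) ≢ route T (hard Q')
  hard-routes-distinct {Q} {Q'} |Q| |Q'| Q<a Q'<a Q≢Q' same
    with first-difference Q Q' (trans |Q| (sym |Q'|)) Q≢Q'
  ... | C , x , y , R , R' , refl , refl , x≢y , |R|
    with ++-[0]-head R 0<a (All.tail (All.++⁻ʳ C Q<a))
  ... | y' , rest , R0≡ , y'<a
    = lzLengths-merge-≢ x≢y (All.++⁻ˡ C Q<a) (All.head (All.++⁻ʳ C Q<a)) (All.head (All.++⁻ʳ C Q'<a)) y'<a
        |W| (subst₂ (λ S U → lzLengths S ≡ lzLengths U) toList-s toList-u lz-same)
    where
    s t u : Str n
    s = hard (C ++ x ∷ R)
    t = hard (C ++ y ∷ R')
    u = zipWith (twoDigit a) s t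

    lz-same : lzLengths (toList s) ≡ lzLengths (toList u)
    lz-same = findsLZ s u (sym (route-zipWith (twoDigit-preservesOutcomes a) T s t same))

    toList-s : toList s ≡ (pairs (upTo a) ++ C) ++ x ∷ y' ∷ rest
    toList-s = trans (toList-hard |Q|) (trans (hardString-split a C x R) (cong (λ W → _ ++ x ∷ W) R0≡))

    toList-t : toList t ≡ (pairs (upTo a) ++ C) ++ y ∷ R' ++ 0 ∷ []
    toList-t = trans (toList-hard |Q'|) (hardString-split a C y R')

    toList-u : toList u ≡ List.zipWith (twoDigit a) ((pairs (upTo a) ++ C) ++ x ∷ y' ∷ rest) ((pairs (upTo a) ++ C) ++ y ∷ R' ++ 0 ∷ [])
    toList-u = trans (toList-zipWith (twoDigit a) s t) (cong₂ (List.zipWith (twoDigit a)) toList-s toList-t)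

    |W| : length (R' ++ 0 ∷ []) ≡ suc (length rest)
    |W| = trans (length-++ R') (trans (cong (_+ 1) (sym |R|)) (trans (sym (length-++ R)) (cong length R0≡)))

  hard-family-lower-bound : ∃[ t ] AtMostLetters a t × a ^ r ≤ 3 ^ depth T t
  hard-family-lower-bound = from-deep-member (deep-member T family separated nonempty)
    where
    family : List (Str n)
    family = map hard (words (upTo a) r)

    |family| : length family ≡ a ^ r
    |family| = trans (length-map hard (words (upTo a) r)) (trans (length-words (upTo a) r) (cong (_^ r) (length-upTo a)))

    nonempty : 1 ≤ length family
    nonempty = subst (1 ≤_) (sym |family|) (m^n>0 a ⦃ >-nonZero 0<a ⦄ r)

    separated : Separates T family
    separated = AllPairs.map⁺ (AllPairs-mapWithin
      (λ (|Q| , Q∈) (|Q'| , Q'∈) → hard-routes-distinct |Q| |Q'| (All.map ∈-upTo⁻ Q∈) (All.map ∈-upTo⁻ Q'∈))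
      (All.tabulate (∈-words⁻ (upTo a) r)) (words-unique (Unique.upTo⁺ a) r))

    letters : ∀ {Q} → Q ∈ words (upTo a) r → All (_∈ upTo a) (toList (hard Q))
    letters Q∈ with ∈-words⁻ (upTo a) r Q∈
    ... | |Q| , Q⊆ = subst (All (_∈ upTo a)) (sym (toList-hard |Q|))
                       (All.++⁺ (pairs-letters (upTo a)) (All.++⁺ Q⊆ (∈-upTo⁺ 0<a ∷ [])))

    from-deep-member : ∃[ t ] t ∈ family × length family ≤ 3 ^ depth T t →
                       ∃[ t ] AtMostLetters a t × a ^ r ≤ 3 ^ depth T t
    from-deep-member (t , t∈family , bound) with ∈-map⁻ hard t∈family
    ... | Q , Q∈ , refl = hard Q , (upTo a , ≤-reflexive (length-upTo a) , letters Q∈) ,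
                          subst (_≤ 3 ^ depth T (hard Q)) |family| bound

-- Choosing the parameters

2*⌊n/2⌋≤n : ∀ n → 2 * ⌊ n /2⌋ ≤ n
2*⌊n/2⌋≤n n = ≤-trans (+-monoʳ-≤ ⌊ n /2⌋ (≤-trans (≤-reflexive (+-identityʳ ⌊ n /2⌋)) (⌊n/2⌋≤⌈n/2⌉ n)))
                      (≤-reflexive (⌊n/2⌋+⌈n/2⌉≡n n))

2^⌊log₂n⌋≤n : ∀ n → 1 ≤ n → 2 ^ ⌊log₂ n ⌋ ≤ n
2^⌊log₂n⌋≤n n 1≤n = bound ⌊log₂ n ⌋ n 1≤n refl
  where
  bound : ∀ ℓ m → 1 ≤ m → ⌊log₂ m ⌋ ≡ ℓ → 2 ^ ℓ ≤ m
  bound zero    m                 1≤m _    = 1≤m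
  bound (suc k) (suc zero)        _   ()
  bound (suc k) m@(suc (suc _)) _   logm =
    ≤-trans (*-monoʳ-≤ 2 (bound k ⌊ m /2⌋ (s≤s z≤n) (trans (⌊log₂⌊n/2⌋⌋≡⌊log₂n⌋∸1 m) (cong (_∸ 1) logm))))
            (2*⌊n/2⌋≤n m)

2^-cancel-≤ : ∀ m k → 2 ^ m ≤ 2 ^ k → m ≤ k
2^-cancel-≤ m k 2^m≤2^k with m ≤? k
... | yes m≤k = m≤k
... | no  m≰k = contradiction 2^m≤2^k (<⇒≱ (^-monoʳ-< 2 (s≤s (s≤s z≤n)) (≰⇒> m≰k)))

quarter-up : ∀ ℓ → ∃[ h ] h ≤ ℓ × ℓ ≤ 4 * h × 4 * h ≤ ℓ + 4
quarter-up zero       = 0 , z≤n , z≤n , z≤n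
quarter-up ℓ@(suc _) = suc (ℓ / 4) , ℓ/4<ℓ , ℓ≤4h , 4h≤ℓ+4
  where
  ℓ/4<ℓ : ℓ / 4 < ℓ
  ℓ/4<ℓ = m/n<m ℓ 4 (s≤s (s≤s z≤n))

  ℓ≤4h : ℓ ≤ 4 * suc (ℓ / 4)
  ℓ≤4h = begin
    ℓ                       ≡⟨ m≡m%n+[m/n]*n ℓ 4 ⟩
    ℓ % 4 + ℓ / 4 * 4       ≤⟨ +-monoˡ-≤ (ℓ / 4 * 4) (<⇒≤ (m%n<n ℓ 4)) ⟩
    4 + ℓ / 4 * 4           ≡⟨ trans (cong (4 +_) (*-comm (ℓ / 4) 4)) (sym (*-suc 4 (ℓ / 4))) ⟩
    4 * suc (ℓ / 4)         ∎
    where open ≤-Reasoning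

  4h≤ℓ+4 : 4 * suc (ℓ / 4) ≤ ℓ + 4
  4h≤ℓ+4 = begin
    4 * suc (ℓ / 4)         ≡⟨ trans (*-suc 4 (ℓ / 4)) (cong (4 +_) (*-comm 4 (ℓ / 4))) ⟩
    4 + ℓ / 4 * 4           ≤⟨ +-monoʳ-≤ 4 (m/n*n≤m ℓ 4) ⟩
    4 + ℓ                   ≡⟨ +-comm 4 ℓ ⟩
    ℓ + 4                   ∎
    where open ≤-Reasoning

square≤16n⇒4x+2≤n : ∀ x n → x * x ≤ 16 * n → 258 ≤ n → 4 * x + 2 ≤ n
square≤16n⇒4x+2≤n x n x²≤16n 258≤n with x ≤? 64
... | yes x≤64 = ≤-trans (+-monoˡ-≤ 2 (*-monoʳ-≤ 4 x≤64)) 258≤n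
... | no  x≰64 = *-cancelˡ-≤ 16 (begin
  16 * (4 * x + 2)  ≡⟨ trans (*-distribˡ-+ 16 (4 * x) 2) (cong (_+ 32) (sym (*-assoc 16 4 x))) ⟩
  64 * x + 32       ≤⟨ +-monoʳ-≤ (64 * x) (≤-trans (m≤n+m 32 33) 65≤x) ⟩
  64 * x + x        ≡⟨ +-comm (64 * x) x ⟩
  65 * x            ≤⟨ *-monoˡ-≤ x 65≤x ⟩
  x * x             ≤⟨ x²≤16n ⟩
  16 * n            ∎)
  where
  open ≤-Reasoning
  65≤x : 65 ≤ x
  65≤x = ≰⇒> x≰64

-- With h = ⌈ℓ/4⌉ one has 4^h ≤ 4√n, so the 2·4^h + 1 letters outside Q fill at most half of
-- the string once n ≥ 258.
choose-alphabet : ∀ n σ → 258 ≤ n → 1 ≤ σ → σ ≤ n →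
                  ∃[ h ] 2 ^ h ≤ σ × ⌊log₂ σ ⌋ ≤ 4 * h × 2 * (length (pairs (upTo (2 ^ h))) + 1) ≤ n
choose-alphabet n σ 258≤n 1≤σ σ≤n with quarter-up ⌊log₂ σ ⌋
... | h , h≤ℓ , ℓ≤4h , 4h≤ℓ+4 = h , 2^h≤σ , ℓ≤4h , pairs-fit
  where
  open ≤-Reasoning
  a = 2 ^ h

  2^h≤σ : a ≤ σ
  2^h≤σ = ≤-trans (^-monoʳ-≤ 2 h≤ℓ) (2^⌊log₂n⌋≤n σ 1≤σ)

  a²·a²≤16n : (a * a) * (a * a) ≤ 16 * n
  a²·a²≤16n = begin
    (a * a) * (a * a)     ≡⟨ trans (fourth-power a) (^-*-assoc 2 h 4) ⟩
    2 ^ (h * 4)           ≤⟨ ^-monoʳ-≤ 2 (subst (_≤ ⌊log₂ σ ⌋ + 4) (*-comm 4 h) 4h≤ℓ+4) ⟩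
    2 ^ (⌊log₂ σ ⌋ + 4)   ≡⟨ trans (^-distribˡ-+-* 2 ⌊log₂ σ ⌋ 4) (*-comm (2 ^ ⌊log₂ σ ⌋) 16) ⟩
    16 * 2 ^ ⌊log₂ σ ⌋    ≤⟨ *-monoʳ-≤ 16 (≤-trans (2^⌊log₂n⌋≤n σ 1≤σ) σ≤n) ⟩
    16 * n                ∎
    where
    fourth-power : ∀ x → (x * x) * (x * x) ≡ x * (x * (x * (x * 1)))
    fourth-power = solve-∀

  pairs-fit : 2 * (length (pairs (upTo a)) + 1) ≤ n
  pairs-fit = begin
    2 * (length (pairs (upTo a)) + 1) ≡⟨ cong (λ m → 2 * (m + 1)) (trans (length-pairs (upTo a)) (cong (λ k → k * k * 2) (length-upTo a))) ⟩
    2 * (a * a * 2 + 1)               ≡⟨ double a ⟩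
    4 * (a * a) + 2                   ≤⟨ square≤16n⇒4x+2≤n (a * a) n a²·a²≤16n 258≤n ⟩
    n                                 ∎
    where
    double : ∀ x → 2 * (x * x * 2 + 1) ≡ 4 * (x * x) + 2
    double = solve-∀

split-with-half : ∀ {m n} → 2 * m ≤ n → m + (n ∸ m) ≡ n × n ≤ 2 * (n ∸ m)
split-with-half {m} {n} 2m≤n = m+[n∸m]≡n m≤n , (begin
  n                  ≡⟨ sym (m+[n∸m]≡n m≤n) ⟩
  m + (n ∸ m)        ≤⟨ +-monoˡ-≤ (n ∸ m) m≤n∸m ⟩
  (n ∸ m) + (n ∸ m)  ≡⟨ cong ((n ∸ m) +_) (sym (+-identityʳ (n ∸ m))) ⟩
  2 * (n ∸ m)        ∎)
  where
  open ≤-Reasoning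
  m≤n : m ≤ n
  m≤n = ≤-trans (m≤m+n m (m + 0)) 2m≤n

  m≤n∸m : m ≤ n ∸ m
  m≤n∸m = +-cancelˡ-≤ m m (n ∸ m) (subst (m + m ≤_) (sym (m+[n∸m]≡n m≤n))
            (subst (_≤ n) (cong (m +_) (+-identityʳ m)) 2m≤n))

combine-bounds : ∀ {n ℓ r h D} → n ≤ 2 * r → ℓ ≤ 4 * h → h * r ≤ 2 * D → n * ℓ ≤ 16 * D
combine-bounds {n} {ℓ} {r} {h} {D} n≤2r ℓ≤4h hr≤2D = begin
  n * ℓ              ≤⟨ *-mono-≤ n≤2r ℓ≤4h ⟩
  (2 * r) * (4 * h)  ≡⟨ regroup r h ⟩
  8 * (h * r)        ≤⟨ *-monoʳ-≤ 8 hr≤2D ⟩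
  8 * (2 * D)        ≡⟨ sym (*-assoc 8 2 D) ⟩
  16 * D             ∎
  where
  open ≤-Reasoning
  regroup : ∀ r h → (2 * r) * (4 * h) ≡ 8 * (h * r)
  regroup = solve-∀

AtMostLetters-mono : ∀ {n a σ} {t : Str n} → a ≤ σ → AtMostLetters a t → AtMostLetters σ t
AtMostLetters-mono a≤σ (L , |L|≤a , t⊆L) = L , ≤-trans |L|≤a a≤σ , t⊆L

lz-lower-bound-2^ : ∀ {n} h r → length (pairs (upTo (2 ^ h))) + 1 + r ≡ n → (T : DTree n) → FindsLZ T →
                    ∃[ t ] AtMostLetters (2 ^ h) t × h * r ≤ 2 * depth T t
lz-lower-bound-2^ h r |hard| T findsLZ with hard-family-lower-bound (m^n>0 2 h) |hard| T findsLZ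
... | t , letters , bound = t , letters , 2^-cancel-≤ (h * r) (2 * depth T t) (begin
  2 ^ (h * r)        ≡⟨ sym (^-*-assoc 2 h r) ⟩
  (2 ^ h) ^ r        ≤⟨ bound ⟩
  3 ^ depth T t      ≤⟨ ^-monoˡ-≤ (depth T t) (n≤1+n 3) ⟩
  4 ^ depth T t      ≡⟨ ^-*-assoc 2 2 (depth T t) ⟩
  2 ^ (2 * depth T t) ∎)
  where open ≤-Reasoning

theorem1 : Σ ℕ λ d → Σ ℕ λ N → (n σ : ℕ) → N ≤ n → 1 ≤ σ → σ ≤ n →
             (T : DTree n) → FindsLZ T →
             Σ (Str n) λ t → AtMostLetters σ t × n * ⌊log₂ σ ⌋ ≤ d * depth T t
theorem1 = 16 , 258 , λ n σ 258≤n 1≤σ σ≤n T findsLZ →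
  let h , 2^h≤σ , ℓ≤4h , fits = choose-alphabet n σ 258≤n 1≤σ σ≤n
      prefix                    = length (pairs (upTo (2 ^ h))) + 1
      |hard| , n≤2r             = split-with-half {prefix} fits
      t , letters , hr≤2depth   = lz-lower-bound-2^ h (n ∸ prefix) |hard| T findsLZ
  in  t , AtMostLetters-mono 2^h≤σ letters , combine-bounds {h = h} {depth T t} n≤2r ℓ≤4h hr≤2depth
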